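{- Let $t\geq 2$ be a fixed integer, let $\mathcal{G}$ be a class of $K_t$-free graphs, and let $G$ be a graph and $S\subseteq V(G)$ with $|S|\geq 2$ and $G\oplus S\in\mathcal{G}$. Let $u,v$ be any two vertices in $S$. Then: (i) $N(u)\cap N(v)$ induces a $(t-1,t-1)$-split graph with $(t-1,t-1)$-split partition $(T_{uv},S_{uv})$; (ii) $\overline{N[u]}\cap\overline{N[v]}$ induces a $(t-1,t-1)$-split graph with $(t-1,t-1)$-split partition $(T_{\overline{u}\overline{v}},S_{\overline{u}\overline{v}})$; (iii) $N(u)\setminus N[v]$ induces a $(t-1,t-1)$-split graph with $(t-1,t-1)$-split partition $(T_{u\overline{v}},S_{u\overline{v}})$; (iv) $N(v)\setminus N[u]$ induces a $(t-1,t-1)$-split graph with $(t-1,t-1)$-split partition $(T_{\overline{u}v},S_{\overline{u}v})$.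
   Context: All graphs are finite and simple. $N(x)$ is the open neighborhood and $N[x]=N(x)\cup\{x\}$ the closed neighborhood of $x$ in $G$; $\overline{N[x]}=V(G)\setminus N[x]$. For $S\subseteq V(G)$, $G\oplus S$ is the graph obtained from $G$ by complementing the subgraph induced by $S$ (a pair has its adjacency flipped iff both endpoints are in $S$). With respect to $S,u,v$ define: $S_{uv}=S\cap N(u)\cap N(v)$, $S_{\overline{u}\overline{v}}=S\cap\overline{N[u]}\cap\overline{N[v]}$, $S_{u\overline{v}}=S\cap(N(u)\setminus N[v])$, $S_{\overline{u}v}=S\cap(N(v)\setminus N[u])$, $T_{uv}=(N(u)\cap N(v))\setminus S$, $T_{\overline{u}\overline{v}}=(\overline{N[u]}\cap\overline{N[v]})\setminus S$, $T_{u\overline{v}}=(N(u)\setminus N[v])\setminus S$, $T_{\overline{u}v}=(N(v)\setminus N[u])\setminus S$. A graph is a $(p,q)$-split graph if its vertex set can be partitioned into $(P,Q)$ with $G[P]$ $K_{p+1}$-free and $G[Q]$ having no independent set of size $q+1$; such $(P,Q)$ is a $(p,q)$-split partition. -}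

module Defs where

open import Data.Nat using (ℕ; suc; _∸_)
open import Data.Bool using (Bool; true; false; not; _∧_; _xor_; if_then_else_)
open import Data.Fin using (Fin; _≟_)
open import Data.Fin.Subset using (Subset; _∈_; _∩_; _∪_; _─_; ∁; ⁅_⁆; ⊤)
open import Data.Vec using (lookup; tabulate)
open import Data.Product using (Σ; _×_; _,_)
open import Function.Definitions using (Injective)
open import Relation.Nullary using (¬_; does)
open import Relation.Binary.PropositionalEquality using (_≡_; _≢_; refl; sym; cong)

record Graph (n : ℕ) : Set where
  field
    adj    : Fin n → Fin n → Bool
    adj-sym : ∀ x y → adj x y ≡ adj y x
    adj-irr : ∀ x → adj x x ≡ false
open Graph public

flipB : ∀ {n} → Subset n → Fin n → Fin n → Bool
flipB S x y = lookup S x ∧ lookup S y ∧ not (does (x ≟ y))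

private
  ∧-comm : ∀ a b → a ∧ b ≡ b ∧ a
  ∧-comm false false = refl
  ∧-comm false true = refl
  ∧-comm true false = refl
  ∧-comm true true = refl

  ≟-sym : ∀ {n} (x y : Fin n) → does (x ≟ y) ≡ does (y ≟ x)
  ≟-sym x y with x ≟ y | y ≟ x
  ... | Relation.Nullary.yes _ | Relation.Nullary.yes _ = refl
  ... | Relation.Nullary.no _ | Relation.Nullary.no _ = refl
  ... | Relation.Nullary.yes p | Relation.Nullary.no q = Data.Empty.⊥-elim (q (sym p))
    where import Data.Empty
  ... | Relation.Nullary.no p | Relation.Nullary.yes q = Data.Empty.⊥-elim (p (sym q))
    where import Data.Empty

  flip-sym : ∀ {n} (S : Subset n) x y → flipB S x y ≡ flipB S y x
  flip-sym S x y with lookup S x | lookup S y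
  ... | false | false = refl
  ... | false | true = refl
  ... | true | false = refl
  ... | true | true = cong not (≟-sym x y)

  flip-irr : ∀ {n} (S : Subset n) x → flipB S x x ≡ false
  flip-irr S x with x ≟ x
  ... | Relation.Nullary.yes _ = lem (lookup S x)
    where lem : ∀ b → b ∧ b ∧ false ≡ false
          lem false = refl
          lem true = refl
  ... | Relation.Nullary.no ¬p = Data.Empty.⊥-elim (¬p refl)
    where import Data.Empty

  xor-false : ∀ a → a xor false ≡ a
  xor-false false = refl
  xor-false true = refl

-- G ⊕ S : complement the subgraph induced by S.
_⊕_ : ∀ {n} → Graph n → Subset n → Graph n
adj (G ⊕ S) x y = adj G x y xor flipB S x y
adj-sym (G ⊕ S) x y rewrite adj-sym G x y | flip-sym S x y = refl
adj-irr (G ⊕ S) x rewrite adj-irr G x | flip-irr S x = refl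

N : ∀ {n} → Graph n → Fin n → Subset n
N G x = tabulate (adj G x)

N[_] : ∀ {n} → Graph n → Fin n → Subset n
N[ G ] x = N G x ∪ ⁅ x ⁆

Nbar : ∀ {n} → Graph n → Fin n → Subset n
Nbar G x = ∁ (N[ G ] x)

HasClique : ∀ {n} → Graph n → ℕ → Subset n → Set
HasClique {n} G k X =
  Σ (Fin k → Fin n) λ f → Injective _≡_ _≡_ f × (∀ i → f i ∈ X)
    × (∀ i j → i ≢ j → adj G (f i) (f j) ≡ true)

HasIndep : ∀ {n} → Graph n → ℕ → Subset n → Set
HasIndep {n} G k X =
  Σ (Fin k → Fin n) λ f → Injective _≡_ _≡_ f × (∀ i → f i ∈ X)
    × (∀ i j → i ≢ j → adj G (f i) (f j) ≡ false)

KFree : ∀ {n} → ℕ → Graph n → Set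
KFree t G = ¬ HasClique G t ⊤

IsSplitPartition : ∀ {n} → Graph n → ℕ → ℕ → Subset n → Subset n → Subset n → Set
IsSplitPartition G p q X P Q =
  (∀ x → x ∈ X → (x ∈ P) Data.Sum.⊎ (x ∈ Q))
  × (∀ x → x ∈ P → x ∈ X) × (∀ x → x ∈ Q → x ∈ X)
  × (∀ x → x ∈ P → ¬ (x ∈ Q))
  × ¬ HasClique G (suc p) P
  × ¬ HasIndep G (suc q) Q
  where import Data.Sum

-- On every vertex set X, the partition (X ─ S , S ∩ X) is a (t-1,t-1)-split
-- partition of G[X]: outside S the graphs G and G ⊕ S agree, so a t-clique of
-- G[X ─ S] is a t-clique of G ⊕ S; inside S they are complementary, so an
-- independent t-set of G[S ∩ X] is a t-clique of G ⊕ S. The four regions cut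
-- out by u and v are just four choices of X.
module Submission where

open import Defs
open import Data.Nat using (ℕ; suc; _≥_; _∸_; s≤s; z≤n)
open import Data.Bool using (true; false; not)
open import Data.Bool.Properties using (xor-identityʳ; xor-comm)
open import Data.Fin using (Fin; _≟_)
open import Data.Fin.Subset using (Subset; _∈_; _∉_; _⊆_; _∩_; _─_; ∣_∣; inside; outside)
open import Data.Fin.Subset.Properties using (_∈?_; ⊆⊤; p∩q⊆p; p∩q⊆q; x∈p∩q⁺; p─q⊆p; x∈p∧x∉q⇒x∈p─q)
open import Data.Vec using (_∷_; lookup; here; there)
open import Data.Vec.Properties using ([]=⇒lookup; lookup⇒[]=)
open import Data.Product using (_×_; _,_)
open import Data.Sum using (_⊎_; inj₁; inj₂)
open import Relation.Nullary using (yes; no; contradiction)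
open import Relation.Binary.PropositionalEquality using (_≡_; _≢_; refl; trans; cong; module ≡-Reasoning)
open import Function using (_∘_)

x∈p─q⇒x∉q : ∀ {n} {p q : Subset n} {x} → x ∈ p ─ q → x ∉ q
x∈p─q⇒x∉q {p = _ ∷ _} {inside ∷ _} (there x∈p─q) (there x∈q) = x∈p─q⇒x∉q x∈p─q x∈q
x∈p─q⇒x∉q {p = _ ∷ _} {outside ∷ _} (there x∈p─q) (there x∈q) = x∈p─q⇒x∉q x∈p─q x∈q

x∉p⇒lookup≡false : ∀ {n} {p : Subset n} {x} → x ∉ p → lookup p x ≡ false
x∉p⇒lookup≡false {p = p} {x} x∉p with lookup p x in eq
... | false = refl
... | true  = contradiction (lookup⇒[]= x p eq) x∉p

⊕-adj-outside : ∀ {n} (G : Graph n) {S : Subset n} {x} y → x ∉ S →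
                adj (G ⊕ S) x y ≡ adj G x y
⊕-adj-outside G y x∉S rewrite x∉p⇒lookup≡false x∉S = xor-identityʳ _

⊕-adj-inside : ∀ {n} (G : Graph n) {S : Subset n} {x y} → x ∈ S → y ∈ S → x ≢ y →
               adj (G ⊕ S) x y ≡ not (adj G x y)
⊕-adj-inside G {x = x} {y} x∈S y∈S x≢y
  rewrite []=⇒lookup x∈S | []=⇒lookup y∈S with x ≟ y
... | yes x≡y = contradiction x≡y x≢y
... | no _    = xor-comm (adj G x y) true

HasClique-mono : ∀ {n k} {G : Graph n} {P Q : Subset n} → P ⊆ Q →
                 HasClique G k P → HasClique G k Q
HasClique-mono P⊆Q (f , f-inj , f∈P , clique) = f , f-inj , (λ i → P⊆Q (f∈P i)) , clique

clique-⊕-outside : ∀ {n k} {G : Graph n} {S P : Subset n} → (∀ {x} → x ∈ P → x ∉ S) →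
                   HasClique G k P → HasClique (G ⊕ S) k P
clique-⊕-outside {G = G} P∉S (f , f-inj , f∈P , clique) =
  f , f-inj , f∈P , λ i j i≢j → trans (⊕-adj-outside G (f j) (P∉S (f∈P i))) (clique i j i≢j)

indep⇒clique-⊕-inside : ∀ {n k} {G : Graph n} {S P : Subset n} → P ⊆ S →
                        HasIndep G k P → HasClique (G ⊕ S) k P
indep⇒clique-⊕-inside {G = G} {S} P⊆S (f , f-inj , f∈P , indep) =
  f , f-inj , f∈P , λ i j i≢j → begin
    adj (G ⊕ S) (f i) (f j)  ≡⟨ ⊕-adj-inside G (P⊆S (f∈P i)) (P⊆S (f∈P j)) (i≢j ∘ f-inj) ⟩
    not (adj G (f i) (f j))  ≡⟨ cong not (indep i j i≢j) ⟩
    true                     ∎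
  where open ≡-Reasoning

split-by-membership : ∀ {n} (S X : Subset n) x → x ∈ X → x ∈ X ─ S ⊎ x ∈ S ∩ X
split-by-membership S X x x∈X with x ∈? S
... | yes x∈S = inj₂ (x∈p∩q⁺ (x∈S , x∈X))
... | no  x∉S = inj₁ (x∈p∧x∉q⇒x∈p─q x∈X x∉S)

⊕-splitPartition : ∀ {n p} (G : Graph n) (S : Subset n) → KFree (suc p) (G ⊕ S) →
                   (X : Subset n) → IsSplitPartition G p p X (X ─ S) (S ∩ X)
⊕-splitPartition G S ⊕S-Kfree X =
    split-by-membership S X
  , (λ _ → p─q⊆p X S)
  , (λ _ → p∩q⊆q S X)
  , (λ _ x∈X─S x∈S∩X → x∈p─q⇒x∉q x∈X─S (p∩q⊆p S X x∈S∩X))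
  , (λ clique → ⊕S-Kfree (HasClique-mono {G = G ⊕ S} ⊆⊤ (clique-⊕-outside {G = G} x∈p─q⇒x∉q clique)))
  , (λ indep → ⊕S-Kfree (HasClique-mono {G = G ⊕ S} ⊆⊤ (indep⇒clique-⊕-inside {G = G} (p∩q⊆p S X) indep)))

lemma5 : (t : ℕ) → t ≥ 2
    → (𝒢 : ∀ {m} → Graph m → Set)
    → (∀ {m} (H : Graph m) → 𝒢 H → KFree t H)
    → ∀ {n} (G : Graph n) (S : Subset n) → ∣ S ∣ ≥ 2 → 𝒢 (G ⊕ S)
    → (u v : Fin n) → u ∈ S → v ∈ S → u ≢ v
    → IsSplitPartition G (t ∸ 1) (t ∸ 1) (N G u ∩ N G v)
        ((N G u ∩ N G v) ─ S) (S ∩ (N G u ∩ N G v))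
      × IsSplitPartition G (t ∸ 1) (t ∸ 1) (Nbar G u ∩ Nbar G v)
        ((Nbar G u ∩ Nbar G v) ─ S) (S ∩ (Nbar G u ∩ Nbar G v))
      × IsSplitPartition G (t ∸ 1) (t ∸ 1) (N G u ─ N[ G ] v)
        ((N G u ─ N[ G ] v) ─ S) (S ∩ (N G u ─ N[ G ] v))
      × IsSplitPartition G (t ∸ 1) (t ∸ 1) (N G v ─ N[ G ] u)
        ((N G v ─ N[ G ] u) ─ S) (S ∩ (N G v ─ N[ G ] u))
lemma5 (suc (suc k)) (s≤s (s≤s z≤n)) 𝒢 𝒢⇒KFree {n} G S _ G⊕S∈𝒢 u v _ _ _ =
    split (N G u ∩ N G v)
  , split (Nbar G u ∩ Nbar G v)
  , split (N G u ─ N[ G ] v)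
  , split (N G v ─ N[ G ] u)
  where
  split : (X : Subset n) → IsSplitPartition G (suc k) (suc k) X (X ─ S) (S ∩ X)
  split = ⊕-splitPartition G S (𝒢⇒KFree (G ⊕ S) G⊕S∈𝒢)
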